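{- Let $\psi=1.3247179572\ldots$ be the unique real root of $\lambda^3-\lambda-1$. For $n\geq 11$, the wheel graph $C_{n-1}\vee K_{1}$ has at least $\operatorname{nint}(\psi^{n-1})$ minimal forts, where $\operatorname{nint}(x)$ denotes the integer nearest to $x$.
   Context: A fort of a finite simple graph $H$ is a non-empty subset $F$ of its vertices such that no vertex outside $F$ has exactly one neighbor in $F$; a fort is minimal if no proper subset of it is a fort. $C_{n-1}$ is the cycle of order $n-1$, $K_1$ a single vertex, and $G\vee G'$ the join (disjoint union plus all edges between the two vertex sets). -}

module Defs where

open import Data.Nat using (ℕ; zero; suc; _≡ᵇ_)
open import Data.Bool using (Bool; true; false; _∨_; _∧_)
open import Data.Fin using (Fin; zero; suc; toℕ)
open import Data.Fin.Subset using (Subset; Nonempty; _∉_; _⊆_; _∩_; ∣_∣)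
open import Data.Vec using (tabulate)
open import Data.Integer using (ℤ; +_)
open import Data.Rational using (ℚ; _<_; _≤_; _*_; _+_; _-_; 0ℚ; 1ℚ; ½)
open import Data.List using (List; length)
open import Data.List.Relation.Unary.All using (All)
open import Data.List.Relation.Unary.Unique.Propositional using (Unique)
open import Data.Product using (Σ; _×_)
open import Relation.Binary.PropositionalEquality using (_≡_; _≢_)

-- A finite simple graph on vertex set Fin n, given by a Boolean adjacency
-- relation (symmetric and irreflexive for the graphs we use).
Graph : ℕ → Set
Graph n = Fin n → Fin n → Bool

nbhd : ∀ {n} → Graph n → Fin n → Subset n
nbhd G v = tabulate (G v)

IsFort : ∀ {n} → Graph n → Subset n → Set
IsFort G F = Nonempty F × (∀ v → v ∉ F → ∣ nbhd G v ∩ F ∣ ≢ 1)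

IsMinimalFort : ∀ {n} → Graph n → Subset n → Set
IsMinimalFort G F = IsFort G F × (∀ F' → F' ⊆ F → IsFort G F' → F' ≡ F)

AtLeastMinimalForts : ∀ {n} → ℕ → Graph n → Set
AtLeastMinimalForts {n} k G =
  Σ (List (Subset n)) λ L → Unique L × All (IsMinimalFort G) L × (k Data.Nat.≤ length L)

-- Adjacency in the cycle C_m on vertices 0,…,m-1 (i ~ i+1 mod m), m ≥ 3.
cycAdj : (m : ℕ) → Fin m → Fin m → Bool
cycAdj m i j =
  (toℕ j ≡ᵇ suc (toℕ i)) ∨ (toℕ i ≡ᵇ suc (toℕ j))
  ∨ ((toℕ i ≡ᵇ 0) ∧ (suc (toℕ j) ≡ᵇ m))
  ∨ ((toℕ j ≡ᵇ 0) ∧ (suc (toℕ i) ≡ᵇ m))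

-- Wheel graph C_{n-1} ∨ K_1 on n vertices: vertex zero is the hub (K_1),
-- vertices suc i (i : Fin (n-1)) form the rim cycle C_{n-1}.
wheel : (n : ℕ) → Graph n
wheel zero ()
wheel (suc m) zero zero = false
wheel (suc m) zero (suc j) = true
wheel (suc m) (suc i) zero = true
wheel (suc m) (suc i) (suc j) = cycAdj m i j

pow : ℚ → ℕ → ℚ
pow q zero = 1ℚ
pow q (suc k) = q * pow q k

cubic : ℚ → ℚ
cubic q = q * q * q - q - 1ℚ

ℕtoℚ : ℕ → ℚ
ℕtoℚ k = + k Data.Rational./ 1

-- IsNintPsiPow m k : k = nint(ψ^m), where ψ is the unique real root of
-- λ³ - λ - 1, i.e. |ψ^m - k| < 1/2.  Expressed without reals: ψ is pinned
-- between rationals p < ψ < p' (for p ≥ 0: p < ψ ⇔ cubic p < 0, and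
-- p' > ψ ⇔ cubic p' > 0, as ψ is the only real root), and
-- k - 1/2 < p^m ≤ ψ^m ≤ p'^m < k + 1/2.  By density of ℚ this is
-- equivalent to k - 1/2 < ψ^m < k + 1/2.
IsNintPsiPow : ℕ → ℕ → Set
IsNintPsiPow m k =
  Σ ℚ λ p → Σ ℚ λ p' →
    (0ℚ ≤ p) × (cubic p < 0ℚ) × (0ℚ < cubic p')
    × (ℕtoℚ k - ½ < pow p m) × (pow p' m < ℕtoℚ k + ½)

-- Let the wheel have hub 0 and rim cycle C_m, m = n - 1. If S is a maximal independent set of
-- C_m, then the rim minus S is a minimal fort, and if S leaves two consecutive rim vertices
-- uncovered, then S together with the hub is a minimal fort. Minimality rests on one
-- observation: if a fort avoids the hub and two consecutive rim vertices u, u⁺, then u⁺ has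
-- at most the neighbour u⁺⁺ in the fort, so u⁺⁺ is outside as well; the gap propagates around
-- the rim and empties the fort.
-- Tilings of the rim by the blocks 10 and 100, together with their rotations by one step, give
-- T(m) = 2 t(m) + 2 t(m - 3) distinct such forts (t(m) = number of tilings), and T obeys the
-- Padovan recurrence T(m + 3) = T(m + 1) + T(m). A rational 0 ≤ p < ψ satisfies
-- p^(j+3) ≤ p^(j+1) + p^j, so p^m ≤ T(m) follows from three initial values, while
-- nint(ψ^m) - 1/2 < p^m for a suitable such p.

module Submission where

open import Defs
open import Data.Product using (∃; _×_; _,_; proj₁; proj₂)
open import Relation.Binary.PropositionalEquality

module PlasticPowers where
  open import Data.Integer as ℤ using (+_)
  import Data.Integer.Properties as ℤₚ
  open import Data.Nat as ℕ using (ℕ; zero; suc)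
  import Data.Nat.Properties as ℕₚ
  import Data.Nat.Coprimality as Coprimality
  open import Data.Rational
    using (ℚ; mkℚ; _/_; _+_; _*_; _-_; -_; _≤_; _<_; _≤?_; _<?_; 0ℚ; 1ℚ; ½; nonNegative)
  open import Data.Rational.Properties
  open import Data.Rational.Solver using (module +-*-Solver)
  open import Data.Empty using (⊥-elim)
  open import Relation.Nullary using (yes; no)
  open import Relation.Nullary.Decidable using (toWitness)
  open +-*-Solver using (solve; _:+_; _:*_; _:-_; _:=_; con)

  private
    variable
      p q r s : ℚ

  0≤1 : 0ℚ ≤ 1ℚ
  0≤1 = toWitness {a? = 0ℚ ≤? 1ℚ} _

  ℕtoℚ≡mkℚ : ∀ a → ℕtoℚ a ≡ mkℚ (+ a) 0 (Coprimality.sym (Coprimality.1-coprimeTo a))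
  ℕtoℚ≡mkℚ a = normalize-coprime (Coprimality.sym (Coprimality.1-coprimeTo a))

  ℕtoℚ-+ : ∀ a b → ℕtoℚ (a ℕ.+ b) ≡ ℕtoℚ a + ℕtoℚ b
  ℕtoℚ-+ a b = begin
    + (a ℕ.+ b) / 1                    ≡⟨ /-cong numerators refl ⟩
    (+ a ℤ.* + 1 ℤ.+ + b ℤ.* + 1) / 1  ≡⟨ cong₂ _+_ (ℕtoℚ≡mkℚ a) (ℕtoℚ≡mkℚ b) ⟨
    ℕtoℚ a + ℕtoℚ b                    ∎
    where
    open ≡-Reasoning
    numerators : + (a ℕ.+ b) ≡ + a ℤ.* + 1 ℤ.+ + b ℤ.* + 1
    numerators = trans (ℤₚ.pos-+ a b) (sym (cong₂ ℤ._+_ (ℤₚ.*-identityʳ (+ a)) (ℤₚ.*-identityʳ (+ b))))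

  ℕtoℚ-nonNeg : ∀ a → 0ℚ ≤ ℕtoℚ a
  ℕtoℚ-nonNeg a = nonNegative⁻¹ (ℕtoℚ a) {{normalize-nonNeg a 1}}

  p≤p+q : ∀ {p q} → 0ℚ ≤ q → p ≤ p + q
  p≤p+q {p} {q} 0≤q = subst (_≤ p + q) (+-identityʳ p) (+-monoʳ-≤ p 0≤q)

  ℕtoℚ-mono-≤ : ∀ {a b} → a ℕ.≤ b → ℕtoℚ a ≤ ℕtoℚ b
  ℕtoℚ-mono-≤ {a} {b} a≤b =
    subst (ℕtoℚ a ≤_) (trans (sym (ℕtoℚ-+ a (b ℕ.∸ a))) (cong ℕtoℚ (ℕₚ.m+[n∸m]≡n a≤b)))
      (p≤p+q (ℕtoℚ-nonNeg (b ℕ.∸ a)))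

  k-½<n⇒k≤n : ∀ k n → ℕtoℚ k - ½ < ℕtoℚ n → k ℕ.≤ n
  k-½<n⇒k≤n k n k-½<n with k ℕ.≤? n
  ... | yes k≤n = k≤n
  ... | no  k≰n = ⊥-elim (<-irrefl refl (begin-strict
    ℕtoℚ n              ≡⟨ +-identityʳ (ℕtoℚ n) ⟨
    ℕtoℚ n + 0ℚ         <⟨ +-monoʳ-< (ℕtoℚ n) (toWitness {a? = 0ℚ <? ½} _) ⟩
    ℕtoℚ n + ½          ≡⟨ solve 1 (λ x → x :+ con ½ := x :+ con 1ℚ :- con ½) refl (ℕtoℚ n) ⟩
    ℕtoℚ n + 1ℚ - ½     ≤⟨ +-monoˡ-≤ (- ½) n+1≤k ⟩
    ℕtoℚ k - ½          <⟨ k-½<n ⟩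
    ℕtoℚ n              ∎))
    where
    open ≤-Reasoning
    n+1≤k : ℕtoℚ n + 1ℚ ≤ ℕtoℚ k
    n+1≤k = subst (_≤ ℕtoℚ k) (ℕtoℚ-+ n 1) (ℕtoℚ-mono-≤ (subst (ℕ._≤ k) (ℕₚ.+-comm 1 n) (ℕₚ.≰⇒> k≰n)))

  *-mono-≤-nonNeg : 0ℚ ≤ p → p ≤ q → 0ℚ ≤ r → r ≤ s → p * r ≤ q * s
  *-mono-≤-nonNeg {p} {q} {r} {s} 0≤p p≤q 0≤r r≤s =
    ≤-trans (*-monoʳ-≤-nonNeg r {{nonNegative 0≤r}} p≤q)
            (*-monoˡ-≤-nonNeg q {{nonNegative (≤-trans 0≤p p≤q)}} r≤s)

  pow-nonNeg : 0ℚ ≤ p → ∀ j → 0ℚ ≤ pow p j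
  pow-nonNeg 0≤p zero    = 0≤1
  pow-nonNeg 0≤p (suc j) = *-mono-≤-nonNeg ≤-refl 0≤p ≤-refl (pow-nonNeg 0≤p j)

  pow-mono-≤ : 0ℚ ≤ p → p ≤ q → ∀ j → pow p j ≤ pow q j
  pow-mono-≤ 0≤p p≤q zero    = ≤-refl
  pow-mono-≤ 0≤p p≤q (suc j) = *-mono-≤-nonNeg 0≤p p≤q (pow-nonNeg 0≤p j) (pow-mono-≤ 0≤p p≤q j)

  cubic<0⇒cube<succ : cubic p < 0ℚ → p * p * p < p + 1ℚ
  cubic<0⇒cube<succ {p} cubic<0 = begin-strict
    p * p * p            ≡⟨ solve 1 (λ x → x :* x :* x := (x :* x :* x :- x :- con 1ℚ) :+ (x :+ con 1ℚ))
                                    refl p ⟩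
    cubic p + (p + 1ℚ)   <⟨ +-monoˡ-< (p + 1ℚ) cubic<0 ⟩
    0ℚ + (p + 1ℚ)        ≡⟨ +-identityˡ (p + 1ℚ) ⟩
    p + 1ℚ               ∎
    where open ≤-Reasoning

  pow-step : 0ℚ ≤ p → cubic p < 0ℚ → ∀ j → pow p (3 ℕ.+ j) ≤ pow p (1 ℕ.+ j) + pow p j
  pow-step {p} 0≤p cubic<0 j = begin
    p * (p * (p * pow p j))   ≡⟨ solve 2 (λ x y → x :* (x :* (x :* y)) := x :* x :* x :* y) refl p (pow p j) ⟩
    p * p * p * pow p j       ≤⟨ *-monoʳ-≤-nonNeg (pow p j) {{nonNegative (pow-nonNeg 0≤p j)}}
                                   (<⇒≤ (cubic<0⇒cube<succ {p} cubic<0)) ⟩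
    (p + 1ℚ) * pow p j        ≡⟨ solve 2 (λ x y → (x :+ con 1ℚ) :* y := x :* y :+ y) refl p (pow p j) ⟩
    p * pow p j + pow p j     ∎
    where open ≤-Reasoning

  cubic-mono-≤ : 1ℚ ≤ q → q ≤ p → cubic q ≤ cubic p
  cubic-mono-≤ {q} {p} 1≤q q≤p = begin
    cubic q                    ≡⟨ factor q ⟩
    (q * q - 1ℚ) * q - 1ℚ      ≤⟨ +-monoˡ-≤ (- 1ℚ) (*-mono-≤-nonNeg 0≤q²-1 q²-1≤p²-1 0≤q q≤p) ⟩
    (p * p - 1ℚ) * p - 1ℚ      ≡⟨ factor p ⟨
    cubic p                    ∎
    where
    open ≤-Reasoning
    factor : ∀ x → cubic x ≡ (x * x - 1ℚ) * x - 1ℚ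
    factor = solve 1 (λ x → x :* x :* x :- x :- con 1ℚ := (x :* x :- con 1ℚ) :* x :- con 1ℚ) refl
    0≤q : 0ℚ ≤ q
    0≤q = ≤-trans 0≤1 1≤q
    q²-1≤p²-1 : q * q - 1ℚ ≤ p * p - 1ℚ
    q²-1≤p²-1 = +-monoˡ-≤ (- 1ℚ) (*-mono-≤-nonNeg 0≤q q≤p 0≤q q≤p)
    0≤q²-1 : 0ℚ ≤ q * q - 1ℚ
    0≤q²-1 = +-monoˡ-≤ (- 1ℚ) (*-mono-≤-nonNeg 0≤1 1≤q 0≤1 1≤q)

  cubic<0⇒≤ : cubic p < 0ℚ → 1ℚ ≤ q → 0ℚ < cubic q → p ≤ q
  cubic<0⇒≤ {p} {q} cubic-p<0 1≤q 0<cubic-q with p ≤? q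
  ... | yes p≤q = p≤q
  ... | no  p≰q = ⊥-elim (<-asym 0<cubic-q (≤-<-trans (cubic-mono-≤ 1≤q (<⇒≤ (≰⇒> p≰q))) cubic-p<0))

  recurrence-dominates : (u v : ℕ → ℚ) → (∀ t → u (3 ℕ.+ t) ≤ u (1 ℕ.+ t) + u t) →
                         (∀ t → v (1 ℕ.+ t) + v t ≤ v (3 ℕ.+ t)) →
                         u 0 ≤ v 0 → u 1 ≤ v 1 → u 2 ≤ v 2 → ∀ t → u t ≤ v t
  recurrence-dominates u v u-rec v-rec u0≤v0 u1≤v1 u2≤v2 t = let (ut≤vt , _ , _) = window t in ut≤vt
    where
    window : ∀ t → u t ≤ v t × u (1 ℕ.+ t) ≤ v (1 ℕ.+ t) × u (2 ℕ.+ t) ≤ v (2 ℕ.+ t)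
    window zero    = u0≤v0 , u1≤v1 , u2≤v2
    window (suc t) = let (ut≤vt , ut+1≤vt+1 , ut+2≤vt+2) = window t in
      ut+1≤vt+1 , ut+2≤vt+2 , ≤-trans (u-rec t) (≤-trans (+-mono-≤ ut+1≤vt+1 ut≤vt) (v-rec t))

  -- 4/3 exceeds ψ, and 18, 24, 32 exceed (4/3)^10, (4/3)^11, (4/3)^12.
  nint-ψ^[10+t]≤ : (T : ℕ → ℕ) → (∀ t → T (3 ℕ.+ t) ≡ T (1 ℕ.+ t) ℕ.+ T t) →
                   18 ℕ.≤ T 0 → 24 ℕ.≤ T 1 → 32 ℕ.≤ T 2 →
                   ∀ t {k} → IsNintPsiPow (10 ℕ.+ t) k → k ℕ.≤ T t
  nint-ψ^[10+t]≤ T T-rec 18≤T0 24≤T1 32≤T2 t {k} (p , _ , 0≤p , cubic-p<0 , _ , k-½<pᵐ , _) =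
    k-½<n⇒k≤n k (T t) (<-≤-trans k-½<pᵐ (recurrence-dominates u v u-rec v-rec
      (base 18 (toWitness {a? = pow 4/3 10 ≤? ℕtoℚ 18} _) 18≤T0)
      (base 24 (toWitness {a? = pow 4/3 11 ≤? ℕtoℚ 24} _) 24≤T1)
      (base 32 (toWitness {a? = pow 4/3 12 ≤? ℕtoℚ 32} _) 32≤T2) t))
    where
    4/3 : ℚ
    4/3 = + 4 / 3
    p≤4/3 : p ≤ 4/3
    p≤4/3 = cubic<0⇒≤ cubic-p<0 (toWitness {a? = 1ℚ ≤? 4/3} _) (toWitness {a? = 0ℚ <? cubic 4/3} _)
    u v : ℕ → ℚ
    u i = pow p (10 ℕ.+ i)
    v i = ℕtoℚ (T i)
    u-rec : ∀ i → u (3 ℕ.+ i) ≤ u (1 ℕ.+ i) + u i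
    u-rec i = pow-step 0≤p cubic-p<0 (10 ℕ.+ i)
    v-rec : ∀ i → v (1 ℕ.+ i) + v i ≤ v (3 ℕ.+ i)
    v-rec i = ≤-reflexive (sym (trans (cong ℕtoℚ (T-rec i)) (ℕtoℚ-+ (T (1 ℕ.+ i)) (T i))))
    base : ∀ {i} c → pow 4/3 (10 ℕ.+ i) ≤ ℕtoℚ c → c ℕ.≤ T i → u i ≤ v i
    base {i} c 4/3ᵐ≤c c≤Ti =
      ≤-trans (pow-mono-≤ 0≤p p≤4/3 (10 ℕ.+ i)) (≤-trans 4/3ᵐ≤c (ℕtoℚ-mono-≤ c≤Ti))

open import Data.Bool using (Bool; true; false; not; _∧_; _∨_; T)
open import Data.Bool.Properties using (¬-not; not-¬; not-injective; T-≡; T-∨; T-∧)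
open import Data.Empty using (⊥-elim)
open import Data.Fin using (Fin; zero; suc; toℕ; fromℕ; fromℕ<; inject₁)
import Data.Fin.Properties as Finₚ
open import Data.Fin.Subset using (Subset; Nonempty; _∈_; _∉_; _⊆_; _∩_; ∣_∣; ⁅_⁆; _-_; ∁)
open import Data.Fin.Subset.Properties
  using (p⊆q⇒∣p∣≤∣q∣; ∣⁅x⁆∣≡1; x∈⁅y⁆⇒x≡y; x∈p∧x≢y⇒x∈p-y; x∈p⇒∣p-x∣<∣p∣)
open import Data.Nat as ℕ using (ℕ; zero; suc; _+_; _*_; _∸_; _≤_; _<_; z≤n; s≤s; _≡ᵇ_)
import Data.Nat.Properties as ℕₚ
open import Data.Sum using (_⊎_; inj₁; inj₂)
import Data.Sum
open import Data.Vec using (Vec; []; _∷_; tabulate; lookup; here; there)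
import Data.Vec.Properties as Vecₚ
open import Function using (_∘_; _⇔_; mk⇔; Equivalence)
open import Relation.Nullary using (¬_; yes; no)
open import Relation.Nullary.Decidable using (toWitness)
open import Data.List using (List; []; _∷_; _++_; map; length)
import Data.List.Properties as Listₚ
open import Data.List.Relation.Unary.All as All using (All; []; _∷_)
import Data.List.Relation.Unary.All.Properties as Allₚ
open import Data.List.Relation.Unary.AllPairs using ([]; _∷_)
open import Data.List.Relation.Unary.Unique.Propositional using (Unique)
import Data.List.Relation.Unary.Unique.Propositional.Properties as Uniqueₚ
open import Data.List.Relation.Binary.Disjoint.Propositional using (Disjoint)

open import Data.Nat.Tactic.RingSolver using (solve-∀)
open PlasticPowers using (nint-ψ^[10+t]≤)

private
  variable
    m n : ℕ

-- Counting elements of subsets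

𝟙 : Bool → ℕ
𝟙 true  = 1
𝟙 false = 0

∣∷∣ : ∀ b (p : Subset n) → ∣ b ∷ p ∣ ≡ 𝟙 b + ∣ p ∣
∣∷∣ true  p = refl
∣∷∣ false p = refl

∣tabulate∣≡0 : (f : Fin n → Bool) → (∀ j → f j ≡ false) → ∣ tabulate f ∣ ≡ 0
∣tabulate∣≡0 {zero}  f f≡false = refl
∣tabulate∣≡0 {suc n} f f≡false rewrite f≡false zero = ∣tabulate∣≡0 (f ∘ suc) (f≡false ∘ suc)

∣tabulate∣-single : (f : Fin n → Bool) (a : Fin n) → (∀ j → f j ≡ true → j ≡ a) →
                    ∣ tabulate f ∣ ≡ 𝟙 (f a)
∣tabulate∣-single {suc n} f zero only-a = begin
  ∣ tabulate f ∣                          ≡⟨ ∣∷∣ (f zero) (tabulate (f ∘ suc)) ⟩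
  𝟙 (f zero) + ∣ tabulate (f ∘ suc) ∣   ≡⟨ cong (𝟙 (f zero) +_) (∣tabulate∣≡0 (f ∘ suc) outside) ⟩
  𝟙 (f zero) + 0                        ≡⟨ ℕₚ.+-identityʳ _ ⟩
  𝟙 (f zero)                            ∎
  where
  open ≡-Reasoning
  outside : ∀ j → f (suc j) ≡ false
  outside j = ¬-not (λ fj → Finₚ.0≢1+n (sym (only-a (suc j) fj)))
∣tabulate∣-single {suc n} f (suc a) only-a = begin
  ∣ tabulate f ∣                          ≡⟨ ∣∷∣ (f zero) (tabulate (f ∘ suc)) ⟩
  𝟙 (f zero) + ∣ tabulate (f ∘ suc) ∣   ≡⟨ cong₂ _+_ (cong 𝟙 (¬-not f0≢true)) rest ⟩
  𝟙 (f (suc a))                         ∎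
  where
  open ≡-Reasoning
  f0≢true : f zero ≢ true
  f0≢true f0 = Finₚ.0≢1+n (only-a zero f0)
  rest : ∣ tabulate (f ∘ suc) ∣ ≡ 𝟙 (f (suc a))
  rest = ∣tabulate∣-single (f ∘ suc) a (λ j fj → Finₚ.suc-injective (only-a (suc j) fj))

∣tabulate∣-pair : (f : Fin n → Bool) {a b : Fin n} → a ≢ b →
                  (∀ j → f j ≡ true → j ≡ a ⊎ j ≡ b) → ∣ tabulate f ∣ ≡ 𝟙 (f a) + 𝟙 (f b)
∣tabulate∣-pair f {zero}  {zero}  a≢b only-ab = ⊥-elim (a≢b refl)
∣tabulate∣-pair f {zero}  {suc b} a≢b only-ab =
  trans (∣∷∣ (f zero) (tabulate (f ∘ suc))) (cong (𝟙 (f zero) +_) (∣tabulate∣-single (f ∘ suc) b only-b))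
  where
  only-b : ∀ j → f (suc j) ≡ true → j ≡ b
  only-b j fj with only-ab (suc j) fj
  ... | inj₂ sj≡sb = Finₚ.suc-injective sj≡sb
∣tabulate∣-pair f {suc a} {zero}  a≢b only-ab =
  trans (∣∷∣ (f zero) (tabulate (f ∘ suc)))
        (trans (cong (𝟙 (f zero) +_) (∣tabulate∣-single (f ∘ suc) a only-a))
               (ℕₚ.+-comm (𝟙 (f zero)) (𝟙 (f (suc a)))))
  where
  only-a : ∀ j → f (suc j) ≡ true → j ≡ a
  only-a j fj with only-ab (suc j) fj
  ... | inj₁ sj≡sa = Finₚ.suc-injective sj≡sa
∣tabulate∣-pair f {suc a} {suc b} a≢b only-ab = begin
  ∣ tabulate f ∣                          ≡⟨ ∣∷∣ (f zero) (tabulate (f ∘ suc)) ⟩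
  𝟙 (f zero) + ∣ tabulate (f ∘ suc) ∣   ≡⟨ cong₂ _+_ (cong 𝟙 (¬-not f0≢true)) rest ⟩
  𝟙 (f (suc a)) + 𝟙 (f (suc b))         ∎
  where
  open ≡-Reasoning
  f0≢true : f zero ≢ true
  f0≢true f0 with only-ab zero f0
  ... | inj₁ ()
  ... | inj₂ ()
  only-ab' : ∀ j → f (suc j) ≡ true → j ≡ a ⊎ j ≡ b
  only-ab' j fj with only-ab (suc j) fj
  ... | inj₁ e = inj₁ (Finₚ.suc-injective e)
  ... | inj₂ e = inj₂ (Finₚ.suc-injective e)
  rest : ∣ tabulate (f ∘ suc) ∣ ≡ 𝟙 (f (suc a)) + 𝟙 (f (suc b))
  rest = ∣tabulate∣-pair (f ∘ suc) (a≢b ∘ cong suc) only-ab'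

x∈p∧y∈p∧x≢y⇒1<∣p∣ : ∀ {p : Subset n} {x y} → x ∈ p → y ∈ p → x ≢ y → 1 < ∣ p ∣
x∈p∧y∈p∧x≢y⇒1<∣p∣ {p = p} {x} {y} x∈p y∈p x≢y = begin-strict
  1           ≡⟨ sym (∣⁅x⁆∣≡1 y) ⟩
  ∣ ⁅ y ⁆ ∣   ≤⟨ p⊆q⇒∣p∣≤∣q∣ ⁅y⁆⊆p-x ⟩
  ∣ p - x ∣   <⟨ x∈p⇒∣p-x∣<∣p∣ x∈p ⟩
  ∣ p ∣       ∎
  where
  open ℕₚ.≤-Reasoning
  ⁅y⁆⊆p-x : ⁅ y ⁆ ⊆ p - x
  ⁅y⁆⊆p-x z∈⁅y⁆ with x∈⁅y⁆⇒x≡y y z∈⁅y⁆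
  ... | refl = x∈p∧x≢y⇒x∈p-y y∈p (x≢y ∘ sym)

tabulate-∩ : (f : Fin n → Bool) (p : Subset n) → tabulate f ∩ p ≡ tabulate (λ j → f j ∧ lookup p j)
tabulate-∩ f []      = refl
tabulate-∩ f (b ∷ p) = cong (f zero ∧ b ∷_) (tabulate-∩ (f ∘ suc) p)

-- The rim cycle

infix 4 _↝_
_↝_ : Fin m → Fin m → Set
_↝_ {m} i j = toℕ j ≡ suc (toℕ i) ⊎ (toℕ j ≡ 0 × suc (toℕ i) ≡ m)

↝-functional : ∀ {i j k : Fin m} → i ↝ j → i ↝ k → j ≡ k
↝-functional (inj₁ j≡i+1) (inj₁ k≡i+1) = Finₚ.toℕ-injective (trans j≡i+1 (sym k≡i+1))
↝-functional {j = j} (inj₁ j≡i+1) (inj₂ (_ , i+1≡m)) =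
  ⊥-elim (ℕₚ.<-irrefl (trans j≡i+1 i+1≡m) (Finₚ.toℕ<n j))
↝-functional {k = k} (inj₂ (_ , i+1≡m)) (inj₁ k≡i+1) =
  ⊥-elim (ℕₚ.<-irrefl (trans k≡i+1 i+1≡m) (Finₚ.toℕ<n k))
↝-functional (inj₂ (j≡0 , _)) (inj₂ (k≡0 , _)) = Finₚ.toℕ-injective (trans j≡0 (sym k≡0))

↝-injective : ∀ {i j k : Fin m} → i ↝ k → j ↝ k → i ≡ j
↝-injective (inj₁ k≡i+1) (inj₁ k≡j+1) = Finₚ.toℕ-injective (ℕₚ.suc-injective (trans (sym k≡i+1) k≡j+1))
↝-injective (inj₁ k≡i+1) (inj₂ (k≡0 , _)) = ⊥-elim (ℕₚ.1+n≢0 (trans (sym k≡i+1) k≡0))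
↝-injective (inj₂ (k≡0 , _)) (inj₁ k≡j+1) = ⊥-elim (ℕₚ.1+n≢0 (trans (sym k≡j+1) k≡0))
↝-injective (inj₂ (_ , i+1≡m)) (inj₂ (_ , j+1≡m)) =
  Finₚ.toℕ-injective (ℕₚ.suc-injective (trans i+1≡m (sym j+1≡m)))

↝-2-cycle⇒m≤2 : ∀ {i j : Fin m} → i ↝ j → j ↝ i → m ≤ 2
↝-2-cycle⇒m≤2 {i = i} (inj₁ j≡i+1) (inj₁ i≡j+1) =
  ⊥-elim (ℕₚ.<-irrefl (trans i≡j+1 (cong suc j≡i+1)) (ℕₚ.m<n⇒m<1+n (ℕₚ.n<1+n (toℕ i))))
↝-2-cycle⇒m≤2 (inj₁ j≡i+1) (inj₂ (i≡0 , j+1≡m)) =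
  ℕₚ.≤-reflexive (trans (sym j+1≡m) (cong suc (trans j≡i+1 (cong suc i≡0))))
↝-2-cycle⇒m≤2 (inj₂ (j≡0 , i+1≡m)) (inj₁ i≡j+1) =
  ℕₚ.≤-reflexive (trans (sym i+1≡m) (cong suc (trans i≡j+1 (cong suc j≡0))))
↝-2-cycle⇒m≤2 (inj₂ (_ , i+1≡m)) (inj₂ (i≡0 , _)) =
  ℕₚ.m≤n⇒m≤1+n (ℕₚ.≤-reflexive (trans (sym i+1≡m) (cong suc i≡0)))

next : Fin m → Fin m
next {suc m} i with suc (toℕ i) ℕ.<? suc m
... | yes i+1<m = fromℕ< i+1<m
... | no  _     = zero

prev : Fin m → Fin m
prev {suc m} zero    = fromℕ m
prev {suc m} (suc i) = inject₁ i

i↝next : (i : Fin m) → i ↝ next i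
i↝next {suc m} i with suc (toℕ i) ℕ.<? suc m
... | yes i+1<m = inj₁ (Finₚ.toℕ-fromℕ< i+1<m)
... | no  i+1≮m = inj₂ (refl , ℕₚ.≤-antisym (Finₚ.toℕ<n i) (ℕₚ.≮⇒≥ i+1≮m))

prev↝i : (i : Fin m) → prev i ↝ i
prev↝i {suc m} zero    = inj₂ (refl , cong suc (Finₚ.toℕ-fromℕ m))
prev↝i {suc m} (suc i) = inj₁ (cong suc (sym (Finₚ.toℕ-inject₁ i)))

↝⇒≡next : ∀ {i j : Fin m} → i ↝ j → j ≡ next i
↝⇒≡next {i = i} i↝j = ↝-functional i↝j (i↝next i)

↝⇒≡prev : ∀ {i j : Fin m} → j ↝ i → j ≡ prev i
↝⇒≡prev {i = i} j↝i = ↝-injective j↝i (prev↝i i)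

toℕ-next : (i : Fin m) → suc (toℕ i) < m → toℕ (next i) ≡ suc (toℕ i)
toℕ-next i i+1<m with i↝next i
... | inj₁ next≡i+1     = next≡i+1
... | inj₂ (_ , i+1≡m) = ⊥-elim (ℕₚ.<-irrefl i+1≡m i+1<m)

next-prev : (i : Fin m) → next (prev i) ≡ i
next-prev i = sym (↝⇒≡next (prev↝i i))

prev-next : (i : Fin m) → prev (next i) ≡ i
prev-next i = sym (↝⇒≡prev (i↝next i))

next≢prev : 3 ≤ m → (i : Fin m) → next i ≢ prev i
next≢prev 3≤m i next≡prev =
  ℕₚ.<⇒≱ 3≤m (↝-2-cycle⇒m≤2 (i↝next i) (subst (_↝ i) (sym next≡prev) (prev↝i i)))

next-induction : (P : Fin m → Set) → (∀ i → P i → P (next i)) → ∀ {x} → P x → ∀ y → P y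
next-induction {suc m} P step {x} Px y =
  forward (subst P last→zero (step _ (forward Px (Finₚ.≤fromℕ x)))) z≤n
  where
  reach : ∀ d {i j} → toℕ i + d ≡ toℕ j → P i → P j
  reach zero    {i} i+0≡j Pi = subst P (Finₚ.toℕ-injective (trans (sym (ℕₚ.+-identityʳ (toℕ i))) i+0≡j)) Pi
  reach (suc d) {i} {j} i+d+1≡j Pi = reach d (trans (cong (_+ d) (toℕ-next i i+1<m)) i+1+d≡j) (step i Pi)
    where
    i+1+d≡j : suc (toℕ i) + d ≡ toℕ j
    i+1+d≡j = trans (sym (ℕₚ.+-suc (toℕ i) d)) i+d+1≡j
    i+1<m : suc (toℕ i) < suc m
    i+1<m = ℕₚ.≤-<-trans (ℕₚ.≤-trans (ℕₚ.m≤m+n (suc (toℕ i)) d) (ℕₚ.≤-reflexive i+1+d≡j))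
                         (Finₚ.toℕ<n j)
  forward : ∀ {i j} → P i → toℕ i ≤ toℕ j → P j
  forward Pi i≤j = reach _ (ℕₚ.m+[n∸m]≡n i≤j) Pi
  last→zero : next (fromℕ m) ≡ zero
  last→zero = sym (↝⇒≡next (inj₂ (refl , cong suc (Finₚ.toℕ-fromℕ m))))

cycAdj⇔↝ : (i j : Fin m) → cycAdj m i j ≡ true ⇔ (i ↝ j ⊎ j ↝ i)
cycAdj⇔↝ {m} i j = mk⇔ adj⇒↝ ↝⇒adj
  where
  open Equivalence
  A B C D : Bool
  A = toℕ j ≡ᵇ suc (toℕ i)
  B = toℕ i ≡ᵇ suc (toℕ j)
  C = (toℕ i ≡ᵇ 0) ∧ (suc (toℕ j) ≡ᵇ m)
  D = (toℕ j ≡ᵇ 0) ∧ (suc (toℕ i) ≡ᵇ m)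
  ≡ᵇ⇒≡ : ∀ {a b} → T (a ≡ᵇ b) → a ≡ b
  ≡ᵇ⇒≡ {a} {b} = ℕₚ.≡ᵇ⇒≡ a b
  ≡⇒≡ᵇ : ∀ {a b} → a ≡ b → T (a ≡ᵇ b)
  ≡⇒≡ᵇ {a} {b} = ℕₚ.≡⇒≡ᵇ a b
  split : T (A ∨ B ∨ C ∨ D) → T A ⊎ T B ⊎ T C ⊎ T D
  split = Data.Sum.map₂ (Data.Sum.map₂ (T-∨ {C} {D} .to) ∘ T-∨ {B} {C ∨ D} .to) ∘ T-∨ {A} {B ∨ C ∨ D} .to
  merge : T A ⊎ T B ⊎ T C ⊎ T D → T (A ∨ B ∨ C ∨ D)
  merge = T-∨ {A} {B ∨ C ∨ D} .from ∘ Data.Sum.map₂ (T-∨ {B} {C ∨ D} .from ∘ Data.Sum.map₂ (T-∨ {C} {D} .from))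
  adj⇒↝ : cycAdj m i j ≡ true → i ↝ j ⊎ j ↝ i
  adj⇒↝ adj with split (T-≡ .from adj)
  ... | inj₁ j≡i+1        = inj₁ (inj₁ (≡ᵇ⇒≡ j≡i+1))
  ... | inj₂ (inj₁ i≡j+1) = inj₂ (inj₁ (≡ᵇ⇒≡ i≡j+1))
  ... | inj₂ (inj₂ (inj₁ c)) = let (i≡0 , j+1≡m) = T-∧ .to c in
    inj₂ (inj₂ (≡ᵇ⇒≡ i≡0 , ≡ᵇ⇒≡ j+1≡m))
  ... | inj₂ (inj₂ (inj₂ d)) = let (j≡0 , i+1≡m) = T-∧ .to d in
    inj₁ (inj₂ (≡ᵇ⇒≡ j≡0 , ≡ᵇ⇒≡ i+1≡m))
  ↝⇒adj : i ↝ j ⊎ j ↝ i → cycAdj m i j ≡ true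
  ↝⇒adj (inj₁ (inj₁ j≡i+1))          = T-≡ .to (merge (inj₁ (≡⇒≡ᵇ j≡i+1)))
  ↝⇒adj (inj₂ (inj₁ i≡j+1))          = T-≡ .to (merge (inj₂ (inj₁ (≡⇒≡ᵇ i≡j+1))))
  ↝⇒adj (inj₂ (inj₂ (i≡0 , j+1≡m))) =
    T-≡ .to (merge (inj₂ (inj₂ (inj₁ (T-∧ .from (≡⇒≡ᵇ i≡0 , ≡⇒≡ᵇ j+1≡m))))))
  ↝⇒adj (inj₁ (inj₂ (j≡0 , i+1≡m))) =
    T-≡ .to (merge (inj₂ (inj₂ (inj₂ (T-∧ .from (≡⇒≡ᵇ j≡0 , ≡⇒≡ᵇ i+1≡m))))))

cycAdj-next : (i : Fin m) → cycAdj m i (next i) ≡ true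
cycAdj-next i = Equivalence.from (cycAdj⇔↝ i (next i)) (inj₁ (i↝next i))

cycAdj-prev : (i : Fin m) → cycAdj m i (prev i) ≡ true
cycAdj-prev i = Equivalence.from (cycAdj⇔↝ i (prev i)) (inj₂ (prev↝i i))

cycAdj⇒next⊎prev : (i j : Fin m) → cycAdj m i j ≡ true → j ≡ next i ⊎ j ≡ prev i
cycAdj⇒next⊎prev i j adj with Equivalence.to (cycAdj⇔↝ i j) adj
... | inj₁ i↝j = inj₁ (↝⇒≡next i↝j)
... | inj₂ j↝i = inj₂ (↝⇒≡prev j↝i)

-- Forts of the wheel

∈⇒lookup≡true : ∀ {p : Subset n} {i} → i ∈ p → lookup p i ≡ true
∈⇒lookup≡true = Vecₚ.[]=⇒lookup

lookup≡true⇒∈ : ∀ {p : Subset n} {i} → lookup p i ≡ true → i ∈ p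
lookup≡true⇒∈ {p = p} {i} = Vecₚ.lookup⇒[]= i p

∉⇒lookup≡false : ∀ {p : Subset n} {i} → i ∉ p → lookup p i ≡ false
∉⇒lookup≡false i∉p = ¬-not (i∉p ∘ lookup≡true⇒∈)

lookup-extensionality : ∀ {p q : Subset n} → (∀ i → lookup p i ≡ lookup q i) → p ≡ q
lookup-extensionality {p = p} {q} p≗q =
  trans (sym (Vecₚ.tabulate∘lookup p)) (trans (Vecₚ.tabulate-cong p≗q) (Vecₚ.tabulate∘lookup q))

rimDegree : Bool → Subset m → Fin m → ℕ
rimDegree hub v i = 𝟙 hub + (𝟙 (lookup v (next i)) + 𝟙 (lookup v (prev i)))

rim-degree : 3 ≤ m → ∀ hub (v : Subset m) i →
             ∣ nbhd (wheel (suc m)) (suc i) ∩ (hub ∷ v) ∣ ≡ rimDegree hub v i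
rim-degree {m} 3≤m hub v i = begin
  ∣ hub ∷ tabulate (cycAdj m i) ∩ v ∣
    ≡⟨ ∣∷∣ hub (tabulate (cycAdj m i) ∩ v) ⟩
  𝟙 hub + ∣ tabulate (cycAdj m i) ∩ v ∣
    ≡⟨ cong (λ p → 𝟙 hub + ∣ p ∣) (tabulate-∩ (cycAdj m i) v) ⟩
  𝟙 hub + ∣ tabulate (λ j → cycAdj m i j ∧ lookup v j) ∣
    ≡⟨ cong (𝟙 hub +_) (∣tabulate∣-pair _ (next≢prev 3≤m i) neighbours) ⟩
  𝟙 hub + (𝟙 (cycAdj m i (next i) ∧ lookup v (next i)) + 𝟙 (cycAdj m i (prev i) ∧ lookup v (prev i)))
    ≡⟨ cong₂ (λ a b → 𝟙 hub + (𝟙 (a ∧ lookup v (next i)) + 𝟙 (b ∧ lookup v (prev i))))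
             (cycAdj-next i) (cycAdj-prev i) ⟩
  rimDegree hub v i
    ∎
  where
  open ≡-Reasoning
  neighbours : ∀ j → cycAdj m i j ∧ lookup v j ≡ true → j ≡ next i ⊎ j ≡ prev i
  neighbours j adj∧j∈v = cycAdj⇒next⊎prev i j (adjacent (cycAdj m i j) adj∧j∈v)
    where
    adjacent : ∀ a {b} → a ∧ b ≡ true → a ≡ true
    adjacent true _ = refl

hub-degree : ∀ hub (v : Subset m) → ∣ nbhd (wheel (suc m)) zero ∩ (hub ∷ v) ∣ ≡ ∣ v ∣
hub-degree hub v = cong ∣_∣ (trans (tabulate-∩ (λ _ → true) v) (Vecₚ.tabulate∘lookup v))

HasGap : Subset m → Set
HasGap v = ∃ λ g → lookup v g ≡ false × lookup v (next g) ≡ false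

record IsMaximalIndependent (v : Subset m) : Set where
  field
    independent      : ∀ i → lookup v i ≡ true → lookup v (next i) ≡ false
    no-three-outside : ∀ i → lookup v i ≡ true ⊎ lookup v (next i) ≡ true ⊎ lookup v (next (next i)) ≡ true

  independent-prev : ∀ i → lookup v i ≡ true → lookup v (prev i) ≡ false
  independent-prev i i∈v = ¬-not λ prev∈v →
    not-¬ (independent (prev i) prev∈v) (trans (cong (lookup v) (next-prev i)) i∈v)

  dominated : ∀ i → lookup v i ≡ false → lookup v (next i) ≡ true ⊎ lookup v (prev i) ≡ true
  dominated i i∉v with no-three-outside (prev i)
  ... | inj₁ prev∈v         = inj₂ prev∈v
  ... | inj₂ (inj₁ i∈v)     = ⊥-elim (not-¬ i∉v (trans (cong (lookup v) (sym (next-prev i))) i∈v))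
  ... | inj₂ (inj₂ next∈v) = inj₁ (subst (λ k → lookup v (next k) ≡ true) (next-prev i) next∈v)

  some-inside : Fin m → ∃ λ t → lookup v t ≡ true
  some-inside i with no-three-outside i
  ... | inj₁ i∈v               = i , i∈v
  ... | inj₂ (inj₁ next∈v)     = next i , next∈v
  ... | inj₂ (inj₂ next²∈v)    = next (next i) , next²∈v

module _ {m} (3≤m : 3 ≤ m) where

  wheelFort⁺ : ∀ {hub} {v : Subset m} → Nonempty (hub ∷ v) → (hub ≡ false → ∣ v ∣ ≢ 1) →
               (∀ i → lookup v i ≡ false → rimDegree hub v i ≢ 1) → IsFort (wheel (suc m)) (hub ∷ v)
  wheelFort⁺ {hub} {v} nonempty hub-condition rim-condition = nonempty , condition
    where
    condition : ∀ x → x ∉ hub ∷ v → ∣ nbhd (wheel (suc m)) x ∩ (hub ∷ v) ∣ ≢ 1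
    condition zero    x∉F = subst (_≢ 1) (sym (hub-degree hub v)) (hub-condition (∉⇒lookup≡false x∉F))
    condition (suc i) x∉F =
      subst (_≢ 1) (sym (rim-degree 3≤m hub v i)) (rim-condition i (∉⇒lookup≡false x∉F))

  wheelFort⁻ : ∀ {hub} {v : Subset m} → IsFort (wheel (suc m)) (hub ∷ v) →
               ∀ i → lookup v i ≡ false → rimDegree hub v i ≢ 1
  wheelFort⁻ {hub} {v} (_ , condition) i i∉v =
    subst (_≢ 1) (rim-degree 3≤m hub v i) (condition (suc i) (λ i∈F → not-¬ i∉v (∈⇒lookup≡true i∈F)))

  hublessFort⇒¬HasGap : ∀ {v : Subset m} → IsFort (wheel (suc m)) (false ∷ v) → ¬ HasGap v
  hublessFort⇒¬HasGap {v} fort (g , gap) = nothing-inside (proj₁ fort)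
    where
    Outside : Fin m → Set
    Outside u = lookup v u ≡ false × lookup v (next u) ≡ false
    step : ∀ u → Outside u → Outside (next u)
    step u (u∉v , next∉v) = next∉v , ¬-not λ next²∈v → wheelFort⁻ fort (next u) next∉v
      (cong₂ (λ a b → 𝟙 a + 𝟙 b) next²∈v (trans (cong (lookup v) (prev-next u)) u∉v))
    nothing-inside : ¬ Nonempty (false ∷ v)
    nothing-inside (suc y , y∈F) = not-¬ (proj₁ (next-induction Outside step gap y)) (∈⇒lookup≡true y∈F)

  complementFort-minimal : ∀ {v : Subset m} → IsMaximalIndependent v →
                           IsMinimalFort (wheel (suc m)) (false ∷ ∁ v)
  complementFort-minimal {v} mis = fort , minimal
    where
    open IsMaximalIndependent mis
    lookup-∁ : ∀ i → lookup (∁ v) i ≡ not (lookup v i)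
    lookup-∁ i = Vecₚ.lookup-map i not v
    inside : ∃ λ t → lookup v t ≡ true
    inside = some-inside (fromℕ< (ℕₚ.≤-trans (s≤s z≤n) 3≤m))
    t = proj₁ inside
    t∈v = proj₂ inside
    next∈∁v : lookup (∁ v) (next t) ≡ true
    next∈∁v = trans (lookup-∁ (next t)) (cong not (independent t t∈v))
    prev∈∁v : lookup (∁ v) (prev t) ≡ true
    prev∈∁v = trans (lookup-∁ (prev t)) (cong not (independent-prev t t∈v))
    fort : IsFort (wheel (suc m)) (false ∷ ∁ v)
    fort = wheelFort⁺ (suc (next t) , lookup≡true⇒∈ next∈∁v) hub-condition rim-condition
      where
      hub-condition : false ≡ false → ∣ ∁ v ∣ ≢ 1
      hub-condition _ = ℕₚ.<⇒≢ 1<∣∁v∣ ∘ sym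
        where
        1<∣∁v∣ : 1 < ∣ ∁ v ∣
        1<∣∁v∣ = x∈p∧y∈p∧x≢y⇒1<∣p∣ {p = ∁ v} (lookup≡true⇒∈ next∈∁v) (lookup≡true⇒∈ prev∈∁v)
                                                (next≢prev 3≤m t)
      rim-condition : ∀ i → lookup (∁ v) i ≡ false → rimDegree false (∁ v) i ≢ 1
      rim-condition i i∉∁v = subst (_≢ 1) (sym degree≡2) λ ()
        where
        i∈v : lookup v i ≡ true
        i∈v = not-injective (trans (sym (lookup-∁ i)) i∉∁v)
        degree≡2 : rimDegree false (∁ v) i ≡ 2
        degree≡2 = cong₂ (λ a b → 𝟙 a + 𝟙 b)
          (trans (lookup-∁ (next i)) (cong not (independent i i∈v)))
          (trans (lookup-∁ (prev i)) (cong not (independent-prev i i∈v)))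
    minimal : ∀ F → F ⊆ false ∷ ∁ v → IsFort (wheel (suc m)) F → F ≡ false ∷ ∁ v
    minimal (true ∷ v′) F⊆ _ with F⊆ here
    ... | ()
    minimal (false ∷ v′) F⊆ fort′ = cong (false ∷_) (lookup-extensionality pointwise)
      where
      v′⊆∁v : ∀ {z} → lookup v′ z ≡ true → lookup v z ≡ false
      v′⊆∁v {z} z∈v′ =
        not-injective (trans (sym (lookup-∁ z)) (∈⇒lookup≡true (F⊆ (there (lookup≡true⇒∈ z∈v′)))))
      v⊆∁v′ : ∀ {z} → lookup v z ≡ true → lookup v′ z ≡ false
      v⊆∁v′ z∈v = ¬-not λ z∈v′ → not-¬ (v′⊆∁v z∈v′) z∈v
      pointwise : ∀ z → lookup v′ z ≡ lookup (∁ v) z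
      pointwise z with lookup v′ z in v′[z]
      ... | true  = sym (trans (lookup-∁ z) (cong not (v′⊆∁v v′[z])))
      ... | false with lookup v z in v[z]
      ...   | true  = sym (trans (lookup-∁ z) (cong not v[z]))
      ...   | false = ⊥-elim (hublessFort⇒¬HasGap fort′ gap)
        where
        gap : HasGap v′
        gap with dominated z v[z]
        ... | inj₁ next∈v = z , v′[z] , v⊆∁v′ next∈v
        ... | inj₂ prev∈v = prev z , v⊆∁v′ prev∈v , trans (cong (lookup v′) (next-prev z)) v′[z]

  hubFort-minimal : ∀ {v : Subset m} → IsMaximalIndependent v → HasGap v →
                    IsMinimalFort (wheel (suc m)) (true ∷ v)
  hubFort-minimal {v} mis (g , g∉v , next∉v) = fort , minimal
    where
    open IsMaximalIndependent mis
    fort : IsFort (wheel (suc m)) (true ∷ v)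
    fort = wheelFort⁺ (zero , here) (λ ()) rim-condition
      where
      some-neighbour : ∀ {a b} → a ≡ true ⊎ b ≡ true → 𝟙 a + 𝟙 b ≢ 0
      some-neighbour (inj₁ refl) ()
      some-neighbour {false} (inj₂ refl) ()
      some-neighbour {true}  (inj₂ refl) ()
      rim-condition : ∀ i → lookup v i ≡ false → rimDegree true v i ≢ 1
      rim-condition i i∉v = some-neighbour (dominated i i∉v) ∘ ℕₚ.suc-injective
    rim⊆ : ∀ {hub v′ z} → hub ∷ v′ ⊆ true ∷ v → lookup v′ z ≡ true → lookup v z ≡ true
    rim⊆ F⊆ z∈v′ = ∈⇒lookup≡true (F⊆ (there (lookup≡true⇒∈ z∈v′)))
    rim⊆ᶜ : ∀ {hub v′ z} → hub ∷ v′ ⊆ true ∷ v → lookup v z ≡ false → lookup v′ z ≡ false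
    rim⊆ᶜ F⊆ z∉v = ¬-not λ z∈v′ → not-¬ z∉v (rim⊆ F⊆ z∈v′)
    minimal : ∀ F → F ⊆ true ∷ v → IsFort (wheel (suc m)) F → F ≡ true ∷ v
    minimal (false ∷ v′) F⊆ fort′ =
      ⊥-elim (hublessFort⇒¬HasGap fort′ (g , rim⊆ᶜ F⊆ g∉v , rim⊆ᶜ F⊆ next∉v))
    minimal (true ∷ v′) F⊆ fort′ = cong (true ∷_) (lookup-extensionality pointwise)
      where
      pointwise : ∀ z → lookup v′ z ≡ lookup v z
      pointwise z with lookup v′ z in v′[z]
      ... | true  = sym (rim⊆ F⊆ v′[z])
      ... | false with lookup v z in v[z]
      ...   | false = refl
      ...   | true  = ⊥-elim (wheelFort⁻ fort′ z v′[z] (cong₂ (λ a b → 1 + (𝟙 a + 𝟙 b))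
                        (rim⊆ᶜ F⊆ (independent z v[z])) (rim⊆ᶜ F⊆ (independent-prev z v[z]))))

-- Tilings of the rim by the blocks 10 and 100

data Tiling : Subset n → Set where
  []    : Tiling []
  10∷_  : ∀ {v : Subset n} → Tiling v → Tiling (true ∷ false ∷ v)
  100∷_ : ∀ {v : Subset n} → Tiling v → Tiling (true ∷ false ∷ false ∷ v)

infixl 9 _!_
_!_ : Vec Bool n → ℕ → Bool
[]      ! _     = false
(b ∷ v) ! zero  = b
(b ∷ v) ! suc k = v ! k

lookup≡! : (v : Vec Bool n) {i : Fin n} {k : ℕ} → toℕ i ≡ k → lookup v i ≡ v ! k
lookup≡! (b ∷ v) {zero}  refl = refl
lookup≡! (b ∷ v) {suc i} refl = lookup≡! v refl

Tiling-head : ∀ {v : Subset (suc n)} → Tiling v → v ! 0 ≡ true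
Tiling-head (10∷ _)  = refl
Tiling-head (100∷ _) = refl

Tiling-inside⇒notLast : ∀ {v : Subset n} → Tiling v → ∀ k → v ! k ≡ true → suc k < n
Tiling-inside⇒notLast (10∷ t)  zero                v!k = s≤s (s≤s z≤n)
Tiling-inside⇒notLast (10∷ t)  (suc (suc k))       v!k = s≤s (s≤s (Tiling-inside⇒notLast t k v!k))
Tiling-inside⇒notLast (100∷ t) zero                v!k = s≤s (s≤s z≤n)
Tiling-inside⇒notLast (100∷ t) (suc (suc (suc k))) v!k = s≤s (s≤s (s≤s (Tiling-inside⇒notLast t k v!k)))

Tiling-independent : ∀ {v : Subset n} → Tiling v → ∀ k → v ! k ≡ true → v ! suc k ≡ false
Tiling-independent (10∷ t)  zero                v!k = refl
Tiling-independent (10∷ t)  (suc (suc k))       v!k = Tiling-independent t k v!k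
Tiling-independent (100∷ t) zero                v!k = refl
Tiling-independent (100∷ t) (suc (suc (suc k))) v!k = Tiling-independent t k v!k

Tiling-no-three-outside : ∀ {v : Subset n} → Tiling v → ∀ k → suc (suc k) < n →
                          v ! k ≡ true ⊎ v ! suc k ≡ true ⊎ v ! suc (suc k) ≡ true
Tiling-no-three-outside (10∷ t)          zero                _ = inj₁ refl
Tiling-no-three-outside (10∷ t@(10∷ _))  (suc zero)          _ = inj₂ (inj₁ refl)
Tiling-no-three-outside (10∷ t@(100∷ _)) (suc zero)          _ = inj₂ (inj₁ refl)
Tiling-no-three-outside (10∷ t)          (suc (suc k)) (s≤s (s≤s k+2<n)) = Tiling-no-three-outside t k k+2<n
Tiling-no-three-outside (100∷ t)         zero                _ = inj₁ refl
Tiling-no-three-outside (100∷ (10∷ _))   (suc zero)          _ = inj₂ (inj₂ refl)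
Tiling-no-three-outside (100∷ (100∷ _))  (suc zero)          _ = inj₂ (inj₂ refl)
Tiling-no-three-outside (100∷ (10∷ _))   (suc (suc zero))    _ = inj₂ (inj₁ refl)
Tiling-no-three-outside (100∷ (100∷ _))  (suc (suc zero))    _ = inj₂ (inj₁ refl)
Tiling-no-three-outside (100∷ t)         (suc (suc (suc k))) (s≤s (s≤s (s≤s k+2<n))) =
  Tiling-no-three-outside t k k+2<n

-- Across the seam between the last and the first vertex, a tiling is safe because it ends in 0
-- and starts with 1.
Tiling⇒IsMaximalIndependent : ∀ {v : Subset (suc n)} → Tiling v → IsMaximalIndependent v
Tiling⇒IsMaximalIndependent {n} {v} t = record
  { independent = independent ; no-three-outside = no-three-outside }
  where
  head : ∀ {i} → toℕ i ≡ 0 → lookup v i ≡ true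
  head i≡0 = trans (lookup≡! v i≡0) (Tiling-head t)
  independent : ∀ i → lookup v i ≡ true → lookup v (next i) ≡ false
  independent i i∈v with i↝next i
  ... | inj₁ next≡i+1    = trans (lookup≡! v next≡i+1) (Tiling-independent t (toℕ i) v!i)
    where v!i = trans (sym (lookup≡! v refl)) i∈v
  ... | inj₂ (_ , i+1≡m) = ⊥-elim (ℕₚ.<-irrefl i+1≡m (Tiling-inside⇒notLast t (toℕ i) v!i))
    where v!i = trans (sym (lookup≡! v refl)) i∈v
  no-three-outside : ∀ i → lookup v i ≡ true ⊎ lookup v (next i) ≡ true ⊎ lookup v (next (next i)) ≡ true
  no-three-outside i with i↝next i
  ... | inj₂ (next≡0 , _) = inj₂ (inj₁ (head next≡0))
  ... | inj₁ next≡i+1 with i↝next (next i)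
  ...   | inj₂ (next²≡0 , _) = inj₂ (inj₂ (head next²≡0))
  ...   | inj₁ next²≡next+1 =
    Data.Sum.map (trans (lookup≡! v refl))
                 (Data.Sum.map (trans (lookup≡! v next≡i+1)) (trans (lookup≡! v next²≡i+2)))
                 (Tiling-no-three-outside t (toℕ i) (subst (_< suc n) next²≡i+2 (Finₚ.toℕ<n (next (next i)))))
    where
    next²≡i+2 : toℕ (next (next i)) ≡ suc (suc (toℕ i))
    next²≡i+2 = trans next²≡next+1 (cong suc next≡i+1)

rotate : Subset m → Subset m
rotate v = tabulate (lookup v ∘ next)

lookup-rotate : (v : Subset m) (i : Fin m) → lookup (rotate v) i ≡ lookup v (next i)
lookup-rotate v = Vecₚ.lookup∘tabulate (lookup v ∘ next)

rotate-injective : ∀ {v w : Subset m} → rotate v ≡ rotate w → v ≡ w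
rotate-injective {v = v} {w} rv≡rw = lookup-extensionality λ i → begin
  lookup v i                  ≡⟨ cong (lookup v) (next-prev i) ⟨
  lookup v (next (prev i))    ≡⟨ lookup-rotate v (prev i) ⟨
  lookup (rotate v) (prev i)  ≡⟨ cong (λ u → lookup u (prev i)) rv≡rw ⟩
  lookup (rotate w) (prev i)  ≡⟨ lookup-rotate w (prev i) ⟩
  lookup w (next (prev i))    ≡⟨ cong (lookup w) (next-prev i) ⟩
  lookup w i                  ∎
  where open ≡-Reasoning

rotate-IsMaximalIndependent : ∀ {v : Subset m} → IsMaximalIndependent v → IsMaximalIndependent (rotate v)
rotate-IsMaximalIndependent {v = v} mis = record
  { independent      = λ i i∈rv → trans (r (next i)) (independent (next i) (trans (sym (r i)) i∈rv))
  ; no-three-outside = λ i →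
      Data.Sum.map (trans (r i)) (Data.Sum.map (trans (r (next i))) (trans (r (next (next i)))))
                   (no-three-outside (next i))
  }
  where
  open IsMaximalIndependent mis
  r = lookup-rotate v

rotate-HasGap : ∀ {v : Subset m} → HasGap v → HasGap (rotate v)
rotate-HasGap {v = v} (g , g∉v , next∉v) =
  prev g ,
  trans (lookup-rotate v (prev g)) (trans (cong (lookup v) (next-prev g)) g∉v) ,
  trans (lookup-rotate v (next (prev g))) (trans (cong (lookup v ∘ next) (next-prev g)) next∉v)

rotate-Tiling-head : ∀ {v : Subset (suc (suc n))} → Tiling v → lookup (rotate v) zero ≡ false
rotate-Tiling-head {v = v} (10∷ _)  = lookup-rotate v zero
rotate-Tiling-head {v = v} (100∷ _) = lookup-rotate v zero

All⇒Disjoint : ∀ {A : Set} {P : A → Set} {xs ys : List A} → All P xs → All (¬_ ∘ P) ys → Disjoint xs ys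
All⇒Disjoint Pxs ¬Pys (v∈xs , v∈ys) = All.lookup ¬Pys v∈ys (All.lookup Pxs v∈xs)

prepend10 : Subset n → Subset (2 + n)
prepend10 v = true ∷ false ∷ v

prepend100 : Subset n → Subset (3 + n)
prepend100 v = true ∷ false ∷ false ∷ v

prepend100-HasGap : ∀ {v : Subset n} → HasGap (prepend100 v)
prepend100-HasGap = suc zero , refl , refl

tilings : (n : ℕ) → List (Subset n)
tilings zero                = [] ∷ []
tilings (suc zero)          = []
tilings (suc (suc zero))    = prepend10 [] ∷ []
tilings (suc (suc (suc n))) = map prepend10 (tilings (suc n)) ++ map prepend100 (tilings n)

tilings-Tiling : ∀ n → All Tiling (tilings n)
tilings-Tiling zero                = [] ∷ []
tilings-Tiling (suc zero)          = []
tilings-Tiling (suc (suc zero))    = (10∷ []) ∷ []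
tilings-Tiling (suc (suc (suc n))) =
  Allₚ.++⁺ (Allₚ.map⁺ (All.map 10∷_ (tilings-Tiling (suc n)))) (Allₚ.map⁺ (All.map 100∷_ (tilings-Tiling n)))

prepend100-injective : ∀ {v w : Subset n} → prepend100 v ≡ prepend100 w → v ≡ w
prepend100-injective = Vecₚ.∷-injectiveʳ ∘ Vecₚ.∷-injectiveʳ ∘ Vecₚ.∷-injectiveʳ

tilings-Unique : ∀ n → Unique (tilings n)
tilings-Unique zero                = [] ∷ []
tilings-Unique (suc zero)          = []
tilings-Unique (suc (suc zero))    = [] ∷ []
tilings-Unique (suc (suc (suc n))) = Uniqueₚ.++⁺
  (Uniqueₚ.map⁺ (Vecₚ.∷-injectiveʳ ∘ Vecₚ.∷-injectiveʳ) (tilings-Unique (suc n)))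
  (Uniqueₚ.map⁺ prepend100-injective (tilings-Unique n))
  (All⇒Disjoint {P = λ v → v ! 2 ≡ true}
    (Allₚ.map⁺ (All.map Tiling-head (tilings-Tiling (suc n))))
    (Allₚ.map⁺ (All.tabulate λ _ ())))

length-tilings : ∀ n → length (tilings (3 + n)) ≡ length (tilings (1 + n)) + length (tilings n)
length-tilings n = trans (Listₚ.length-++ (map prepend10 (tilings (suc n))))
  (cong₂ _+_ (Listₚ.length-map prepend10 (tilings (suc n))) (Listₚ.length-map prepend100 (tilings n)))

withRotations : List (Subset m) → List (Subset m)
withRotations vs = vs ++ map rotate vs

withRotations-All : ∀ {P : Subset m → Set} {vs} → (∀ {v} → P v → P (rotate v)) →
                    All P vs → All P (withRotations vs)
withRotations-All rotate-P Pvs = Allₚ.++⁺ Pvs (Allₚ.map⁺ (All.map rotate-P Pvs))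

withRotations-Unique : ∀ {vs : List (Subset (2 + n))} → Unique vs → All Tiling vs → Unique (withRotations vs)
withRotations-Unique unique tiled = Uniqueₚ.++⁺ unique (Uniqueₚ.map⁺ rotate-injective unique)
  (All⇒Disjoint {P = λ v → v ! 0 ≡ true}
    (All.map Tiling-head tiled)
    (Allₚ.map⁺ (All.map (λ t → not-¬ (rotate-Tiling-head t)) tiled)))

length-withRotations : (vs : List (Subset m)) → length (withRotations vs) ≡ 2 * length vs
length-withRotations vs = trans (Listₚ.length-++ vs)
  (cong (length vs +_) (trans (Listₚ.length-map rotate vs) (sym (ℕₚ.+-identityʳ (length vs)))))

∁-injective : ∀ {p q : Subset n} → ∁ p ≡ ∁ q → p ≡ q
∁-injective {p = p} {q} ∁p≡∁q = lookup-extensionality λ i → not-injective (begin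
  not (lookup p i)  ≡⟨ Vecₚ.lookup-map i not p ⟨
  lookup (∁ p) i    ≡⟨ cong (λ u → lookup u i) ∁p≡∁q ⟩
  lookup (∁ q) i    ≡⟨ Vecₚ.lookup-map i not q ⟩
  not (lookup q i)  ∎)
  where open ≡-Reasoning

complementForts : (m : ℕ) → List (Subset (suc m))
complementForts m = map (λ v → false ∷ ∁ v) (withRotations (tilings m))

hubForts : (r : ℕ) → List (Subset (4 + r))
hubForts r = map (true ∷_) (withRotations (map prepend100 (tilings r)))

complementForts-Unique : ∀ n → Unique (complementForts (2 + n))
complementForts-Unique n = Uniqueₚ.map⁺ (∁-injective ∘ Vecₚ.∷-injectiveʳ)
  (withRotations-Unique (tilings-Unique (2 + n)) (tilings-Tiling (2 + n)))

hubForts-Unique : ∀ r → Unique (hubForts r)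
hubForts-Unique r = Uniqueₚ.map⁺ Vecₚ.∷-injectiveʳ
  (withRotations-Unique (Uniqueₚ.map⁺ prepend100-injective (tilings-Unique r))
                        (Allₚ.map⁺ (All.map 100∷_ (tilings-Tiling r))))

complementForts-minimal : ∀ r → All (IsMinimalFort (wheel (4 + r))) (complementForts (3 + r))
complementForts-minimal r = Allₚ.map⁺ (All.map (complementFort-minimal (ℕₚ.m≤m+n 3 r))
  (withRotations-All rotate-IsMaximalIndependent (All.map Tiling⇒IsMaximalIndependent (tilings-Tiling (3 + r)))))

hubForts-minimal : ∀ r → All (IsMinimalFort (wheel (4 + r))) (hubForts r)
hubForts-minimal r = Allₚ.map⁺ (All.map (λ (mis , gap) → hubFort-minimal (ℕₚ.m≤m+n 3 r) mis gap)
  (withRotations-All {P = λ v → IsMaximalIndependent v × HasGap v}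
    (λ {v} (mis , gap) → rotate-IsMaximalIndependent mis , rotate-HasGap {v = v} gap)
    (Allₚ.map⁺ (All.map (λ t → Tiling⇒IsMaximalIndependent (100∷ t) , prepend100-HasGap) (tilings-Tiling r)))))

length-complementForts : ∀ m → length (complementForts m) ≡ 2 * length (tilings m)
length-complementForts m =
  trans (Listₚ.length-map _ (withRotations (tilings m))) (length-withRotations (tilings m))

length-hubForts : ∀ r → length (hubForts r) ≡ 2 * length (tilings r)
length-hubForts r = begin
  length (hubForts r)                ≡⟨ Listₚ.length-map (true ∷_) (withRotations tilings₁₀₀) ⟩
  length (withRotations tilings₁₀₀)  ≡⟨ length-withRotations tilings₁₀₀ ⟩
  2 * length tilings₁₀₀              ≡⟨ cong (2 *_) (Listₚ.length-map prepend100 (tilings r)) ⟩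
  2 * length (tilings r)             ∎
  where
  open ≡-Reasoning
  tilings₁₀₀ = map prepend100 (tilings r)

minimalFortBound : ℕ → ℕ
minimalFortBound m = 2 * length (tilings m) + 2 * length (tilings (m ∸ 3))

wheel-minimalForts : ∀ r → AtLeastMinimalForts (minimalFortBound (3 + r)) (wheel (4 + r))
wheel-minimalForts r =
  complementForts (3 + r) ++ hubForts r ,
  Uniqueₚ.++⁺ (complementForts-Unique (1 + r)) (hubForts-Unique r)
    (All⇒Disjoint {P = λ F → F ! 0 ≡ false}
                  (Allₚ.map⁺ (All.tabulate λ _ → refl)) (Allₚ.map⁺ (All.tabulate λ _ ()))) ,
  Allₚ.++⁺ (complementForts-minimal r) (hubForts-minimal r) ,
  ℕₚ.≤-reflexive (sym (trans (Listₚ.length-++ (complementForts (3 + r)))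
                             (cong₂ _+_ (length-complementForts (3 + r)) (length-hubForts r))))

minimalFortBound-rec : ∀ t → minimalFortBound (6 + t) ≡ minimalFortBound (4 + t) + minimalFortBound (3 + t)
minimalFortBound-rec t = begin
  2 * L (6 + t) + 2 * L (3 + t)
    ≡⟨ cong₂ (λ a b → 2 * a + 2 * b) (length-tilings (3 + t)) (length-tilings t) ⟩
  2 * (L (4 + t) + L (3 + t)) + 2 * (L (1 + t) + L t)
    ≡⟨ regroup (L (4 + t)) (L (3 + t)) (L (1 + t)) (L t) ⟩
  (2 * L (4 + t) + 2 * L (1 + t)) + (2 * L (3 + t) + 2 * L t)
    ∎
  where
  open ≡-Reasoning
  L : ℕ → ℕ
  L n = length (tilings n)
  regroup : ∀ a b c d → 2 * (a + b) + 2 * (c + d) ≡ (2 * a + 2 * c) + (2 * b + 2 * d)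
  regroup = solve-∀

AtLeastMinimalForts-weaken : ∀ {k l} {G : Graph n} → k ≤ l → AtLeastMinimalForts l G → AtLeastMinimalForts k G
AtLeastMinimalForts-weaken k≤l (forts , unique , minimal , l≤length) =
  forts , unique , minimal , ℕₚ.≤-trans k≤l l≤length

corollary5p2 : (n : ℕ) → 11 ≤ n → (k : ℕ) → IsNintPsiPow (n ∸ 1) k
    → AtLeastMinimalForts k (wheel n)
corollary5p2 n 11≤n k nint with ℕₚ.m≤n⇒∃[o]m+o≡n 11≤n
... | t , refl = AtLeastMinimalForts-weaken {G = wheel (11 + t)} k≤count (wheel-minimalForts (7 + t))
  where
  k≤count : k ≤ minimalFortBound (10 + t)
  k≤count = nint-ψ^[10+t]≤ (λ i → minimalFortBound (10 + i)) (λ i → minimalFortBound-rec (7 + i))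
    (toWitness {a? = 18 ℕ.≤? minimalFortBound 10} _)
    (toWitness {a? = 24 ℕ.≤? minimalFortBound 11} _)
    (toWitness {a? = 32 ℕ.≤? minimalFortBound 12} _) t nint
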